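{- Let $p$ be a prime and let $V$ be a line (one-dimensional subspace) in $\mathbb{Z}_p^2$. Then either $$0 < h_p(V) < 2\sqrt{p} + 1$$ or $$0 \leq h_p(V) - \frac{p}{b} < b$$ for some integer $b$ with $1 \leq b \leq \lceil \sqrt{p} \rceil$.
   Context: $\mathbb{Z}_p$ denotes the field of integers modulo the prime $p$. For $v=(\bar a_1,\dots,\bar a_n)\in\mathbb{Z}_p^n$ with $0\le a_i<p$ the least nonnegative integer representatives of its coordinates, the Nathanson height is $h_p(v)=a_1+\dots+a_n$. For a nonzero subspace $V\subseteq\mathbb{Z}_p^n$, $h_p(V)=\min\{h_p(v): v\in V\setminus\{0\}\}$. -}

module Defs where

open import Data.Nat using (ℕ; _+_; _*_; _≤_; NonZero)
open import Data.Nat.DivMod using (_mod_)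
open import Data.Fin using (Fin; toℕ)
open import Data.Product using (_×_; _,_; ∃)
open import Relation.Binary.PropositionalEquality using (_≡_)
open import Relation.Nullary using (¬_)

-- Vectors of ℤ_p^2; a coordinate is an element of Fin p, identified with
-- its least nonnegative representative toℕ.
Vec2 : ℕ → Set
Vec2 p = Fin p × Fin p

IsZeroVec : ∀ {p} → Vec2 p → Set
IsZeroVec (x , y) = toℕ x ≡ 0 × toℕ y ≡ 0

scale : ∀ {p} .{{_ : NonZero p}} → Fin p → Vec2 p → Vec2 p
scale {p} t (x , y) = ((toℕ t * toℕ x) mod p , (toℕ t * toℕ y) mod p)

height : ∀ {p} → Vec2 p → ℕ
height (x , y) = toℕ x + toℕ y

InLine : ∀ {p} .{{_ : NonZero p}} → Vec2 p → Vec2 p → Set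
InLine {p} g v = ∃ λ (t : Fin p) → v ≡ scale t g

IsLineHeight : ∀ {p} .{{_ : NonZero p}} → Vec2 p → ℕ → Set
IsLineHeight {p} g h =
  (∃ λ (v : Vec2 p) → InLine g v × ¬ IsZeroVec v × height v ≡ h)
  × (∀ (v : Vec2 p) → InLine g v → ¬ IsZeroVec v → h ≤ height v)

module Submission where

-- Let V = span(g), g = (x,y) ≠ 0,
-- have least height h, and let m = ⌊√p⌋, so m² ≤ p < (m+1)².  By Thue's lemma
-- (pigeonhole on the (m+1)² values y·i - x·j modulo p) there is (U,W) ≠ 0 with
-- |U|, |W| ≤ m and y·U ≡ x·W.  If U and W have equal signs, (|U|,|W|) is a point
-- of V, so h ≤ 2m and (h - 1)² < 4p: the first alternative.  Otherwise
-- y·u + x·w ≡ 0 with 1 ≤ u, w ≤ m, where we may take gcd(u,w) = 1 and, exchanging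
-- the coordinates, u ≤ w.  Writing p = w·A + u·B with 1 ≤ B ≤ w yields a point
-- (A,B) of V, hence h·w < p + w²; and every point (a₁,a₂) of V has
-- w·a₁ + u·a₂ ≡ 0, hence p ≤ h·w.  This is the second alternative with b = w.

open import Defs
open import Data.Nat
  using (ℕ; zero; suc; _+_; _*_; _∸_; _≤_; _<_; _⊔_; _%_; _/_; _<?_; z≤n; s≤s;
         NonZero; ≢-nonZero; nonTrivial⇒n>1)
import Data.Nat.Properties as ℕ
open import Data.Nat.Primality using (Prime; prime⇒nonTrivial)
import Data.Nat.Divisibility as ℕ
open import Data.Nat.DivMod using (_mod_; m%n<n; m*[n/m]≡n; m/n*n≡m; m/n≤m; m≥n⇒m/n>0)
open import Data.Nat.Coprimality using (Coprime; coprime-Bézout; prime⇒coprime; coprime-/gcd)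
  renaming (sym to coprime-sym)
open import Data.Nat.GCD using (module Bézout; gcd; gcd[m,n]∣m; gcd[m,n]∣n; gcd[m,n]≢0)
open import Data.Integer using (ℤ; +_; -[1+_]; ∣_∣; 0ℤ; 1ℤ; -1ℤ; _%ℕ_; _/ℕ_; _⊖_)
  renaming (_+_ to _+ᶻ_; _*_ to _*ᶻ_; _-_ to _-ᶻ_; -_ to -ᶻ_)
import Data.Integer.Properties as ℤ
import Data.Integer.Coprimality as ℤ
open import Data.Integer.DivMod using (a≡a%ℕn+[a/ℕn]*n; n%ℕd<d)
open import Data.Integer.Divisibility.Signed as Signed using (divides)
open import Data.Integer.Tactic.RingSolver using (solve-∀)
import Data.Nat.Tactic.RingSolver as ℕ-Ring
open import Data.Fin using (Fin; toℕ; fromℕ<; remQuot; combine)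
import Data.Fin.Properties as Fin
open import Data.Product using (_×_; _,_; ∃; ∃₂; proj₁; proj₂; uncurry)
open import Data.Sum using (_⊎_; inj₁; inj₂) renaming (map to ⊎-map)
open import Relation.Nullary using (¬_; yes; no)
open import Relation.Nullary.Negation using (contradiction)
open import Relation.Binary.PropositionalEquality

infix 4 _∣ᶻ_

_∣ᶻ_ : ℕ → ℤ → Set
n ∣ᶻ e = + n Signed.∣ e

-- Integer combinations of multiples of n are multiples of n.  The identity
-- expressing e as such a combination is in practice supplied by the ring solver.
∣-comb₁ : ∀ {n e₁ e} c₁ → n ∣ᶻ e₁ → e ≡ c₁ *ᶻ e₁ → n ∣ᶻ e
∣-comb₁ c₁ d₁ refl = Signed.∣n⇒∣m*n c₁ d₁

∣-comb₂ : ∀ {n e₁ e₂ e} c₁ c₂ → n ∣ᶻ e₁ → n ∣ᶻ e₂ → e ≡ c₁ *ᶻ e₁ +ᶻ c₂ *ᶻ e₂ → n ∣ᶻ e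
∣-comb₂ c₁ c₂ d₁ d₂ refl = Signed.∣m∣n⇒∣m+n (Signed.∣n⇒∣m*n c₁ d₁) (Signed.∣n⇒∣m*n c₂ d₂)

∣-comb₃ : ∀ {n e₁ e₂ e₃ e} c₁ c₂ c₃ → n ∣ᶻ e₁ → n ∣ᶻ e₂ → n ∣ᶻ e₃ →
          e ≡ c₁ *ᶻ e₁ +ᶻ c₂ *ᶻ e₂ +ᶻ c₃ *ᶻ e₃ → n ∣ᶻ e
∣-comb₃ c₁ c₂ c₃ d₁ d₂ d₃ refl =
  Signed.∣m∣n⇒∣m+n (∣-comb₂ c₁ c₂ d₁ d₂ refl) (Signed.∣n⇒∣m*n c₃ d₃)

∣-multiple : ∀ {n} c → n ∣ᶻ c *ᶻ + n
∣-multiple c = divides c refl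

divisible⇒≥ : ∀ {n a} → n ∣ᶻ + a → 1 ≤ a → n ≤ a
divisible⇒≥ {a = suc _} d _ = ℕ.∣⇒≤ (Signed.∣⇒∣ᵤ d)

+-linear : ∀ a b c d → + (a * b + c * d) ≡ + a *ᶻ + b +ᶻ + c *ᶻ + d
+-linear a b c d = trans (ℤ.pos-+ (a * b) (c * d)) (cong₂ _+ᶻ_ (ℤ.pos-* a b) (ℤ.pos-* c d))

euclid : ∀ {p a} e → Prime p → 0 < a → a < p → p ∣ᶻ + a *ᶻ e → p ∣ᶻ e
euclid {a = suc _} e p-prime _ a<p d =
  Signed.∣ᵤ⇒∣ (ℤ.coprime-divisor (+ _) (+ _) e (prime⇒coprime p-prime a<p) (Signed.∣⇒∣ᵤ d))

∣-small⇒≡0 : ∀ {n z} → n ∣ᶻ z → ∣ z ∣ < n → z ≡ 0ℤ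
∣-small⇒≡0 {n} {z} d lt with ∣ z ∣ in eq
... | zero  = ℤ.∣i∣≡0⇒i≡0 eq
... | suc k = contradiction (subst (ℕ._∣_ n) eq (Signed.∣⇒∣ᵤ d)) (ℕ.>⇒∤ lt)

distance≤max : ∀ a b → ∣ + a -ᶻ + b ∣ ≤ a ⊔ b
distance≤max a b = subst (_≤ a ⊔ b) (cong ∣_∣ (sym (ℤ.[+m]-[+n]≡m⊖n a b))) (ℤ.∣m⊝n∣≤m⊔n a b)

residues-eq : ∀ {n a b} → n ∣ᶻ + a -ᶻ + b → a < n → b < n → a ≡ b
residues-eq {n} {a} {b} d a<n b<n = ℤ.+-injective (ℤ.i-j≡0⇒i≡j (+ a) (+ b) (∣-small⇒≡0 d small))
  where
  small : ∣ + a -ᶻ + b ∣ < n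
  small = ℕ.≤-<-trans (distance≤max a b) (ℕ.⊔-pres-<m a<n b<n)

reduce : ∀ {n} .{{_ : NonZero n}} z → n ∣ᶻ + (z %ℕ n) -ᶻ z
reduce {n} z = ∣-comb₁ (-ᶻ (z /ℕ n)) (∣-multiple {n} 1ℤ) (residue-identity (a≡a%ℕn+[a/ℕn]*n z n))
  where
  residue-identity : z ≡ + (z %ℕ n) +ᶻ z /ℕ n *ᶻ + n →
                     + (z %ℕ n) -ᶻ z ≡ -ᶻ (z /ℕ n) *ᶻ (1ℤ *ᶻ + n)
  residue-identity eq = trans (cong (λ t → + (z %ℕ n) -ᶻ t) eq) (ring (+ (z %ℕ n)) (z /ℕ n) (+ n))
    where ring : ∀ r q n → r -ᶻ (r +ᶻ q *ᶻ n) ≡ -ᶻ q *ᶻ (1ℤ *ᶻ n)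
          ring = solve-∀

same-residue : ∀ {n} .{{_ : NonZero n}} z₁ z₂ → z₁ %ℕ n ≡ z₂ %ℕ n → n ∣ᶻ z₁ -ᶻ z₂
same-residue {n} z₁ z₂ eq = ∣-comb₂ -1ℤ 1ℤ (reduce {n} z₁) (reduce {n} z₂) identity
  where
  ring : ∀ r z₁ z₂ → z₁ -ᶻ z₂ ≡ -1ℤ *ᶻ (r -ᶻ z₁) +ᶻ 1ℤ *ᶻ (r -ᶻ z₂)
  ring = solve-∀
  identity : z₁ -ᶻ z₂ ≡ -1ℤ *ᶻ (+ (z₁ %ℕ n) -ᶻ z₁) +ᶻ 1ℤ *ᶻ (+ (z₂ %ℕ n) -ᶻ z₂)
  identity rewrite eq = ring (+ (z₂ %ℕ n)) z₁ z₂

inverse : ∀ {a n} → Coprime a n → ∃ λ s → n ∣ᶻ + a *ᶻ s -ᶻ 1ℤ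
inverse {a} {n} c with coprime-Bézout c
... | Bézout.+- x y eq = + x , ∣-comb₁ (+ y) (∣-multiple {n} 1ℤ) (identity (cast eq))
  where
  cast : 1 + y * n ≡ x * a → 1ℤ +ᶻ + y *ᶻ + n ≡ + x *ᶻ + a
  cast eq = trans (sym (cong (1ℤ +ᶻ_) (ℤ.pos-* y n))) (trans (cong +_ eq) (ℤ.pos-* x a))
  identity : 1ℤ +ᶻ + y *ᶻ + n ≡ + x *ᶻ + a → + a *ᶻ + x -ᶻ 1ℤ ≡ + y *ᶻ (1ℤ *ᶻ + n)
  identity e = trans (cong (_-ᶻ 1ℤ) (trans (ℤ.*-comm (+ a) (+ x)) (sym e))) (ring (+ y) (+ n))
    where ring : ∀ y n → 1ℤ +ᶻ y *ᶻ n -ᶻ 1ℤ ≡ y *ᶻ (1ℤ *ᶻ n)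
          ring = solve-∀
... | Bézout.-+ x y eq = -ᶻ + x , ∣-comb₁ (-ᶻ + y) (∣-multiple {n} 1ℤ) (identity (cast eq))
  where
  cast : 1 + x * a ≡ y * n → 1ℤ +ᶻ + x *ᶻ + a ≡ + y *ᶻ + n
  cast eq = trans (sym (cong (1ℤ +ᶻ_) (ℤ.pos-* x a))) (trans (cong +_ eq) (ℤ.pos-* y n))
  identity : 1ℤ +ᶻ + x *ᶻ + a ≡ + y *ᶻ + n → + a *ᶻ -ᶻ + x -ᶻ 1ℤ ≡ -ᶻ + y *ᶻ (1ℤ *ᶻ + n)
  identity e = trans (ring (+ a) (+ x)) (trans (cong -ᶻ_ e) (ring′ (+ y) (+ n)))
    where ring : ∀ a x → a *ᶻ -ᶻ x -ᶻ 1ℤ ≡ -ᶻ (1ℤ +ᶻ x *ᶻ a)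
          ring = solve-∀
          ring′ : ∀ y n → -ᶻ (y *ᶻ n) ≡ -ᶻ y *ᶻ (1ℤ *ᶻ n)
          ring′ = solve-∀

congruent⇒mod≡ : ∀ {n} .{{_ : NonZero n}} c a → n ∣ᶻ + c -ᶻ + a → a < n → c % n ≡ a
congruent⇒mod≡ {n} c a d a<n =
  residues-eq (∣-comb₂ 1ℤ 1ℤ (reduce {n} (+ c)) d (ring (+ (c % n)) (+ c) (+ a))) (m%n<n c n) a<n
  where ring : ∀ r c a → r -ᶻ a ≡ 1ℤ *ᶻ (r -ᶻ c) +ᶻ 1ℤ *ᶻ (c -ᶻ a)
        ring = solve-∀

det : ℕ → ℕ → ℕ → ℕ → ℤ
det x y a₁ a₂ = + y *ᶻ + a₁ -ᶻ + x *ᶻ + a₂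

-- (a₁,a₂) lies on the line through (x,y) modulo p.  For (x,y) ≢ 0 and p prime
-- this is membership in the span of (x,y), see onLine⇒multiple.
OnLine : ℕ → ℕ → ℕ → ℕ → ℕ → Set
OnLine p x y a₁ a₂ = p ∣ᶻ det x y a₁ a₂

onLine-swap : ∀ {p x y a₁ a₂} → OnLine p x y a₁ a₂ → OnLine p y x a₂ a₁
onLine-swap {x = x} {y} {a₁} {a₂} d = ∣-comb₁ -1ℤ d (ring (+ x) (+ y) (+ a₁) (+ a₂))
  where ring : ∀ x y a₁ a₂ → x *ᶻ a₂ -ᶻ y *ᶻ a₁ ≡ -1ℤ *ᶻ (y *ᶻ a₁ -ᶻ x *ᶻ a₂)
        ring = solve-∀

multiple-onLine : ∀ {p} .{{_ : NonZero p}} t x y → OnLine p x y ((t * x) % p) ((t * y) % p)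
multiple-onLine {p} t x y =
  ∣-comb₂ (+ y) (-ᶻ + x) (reduce {p} (+ (t * x))) (reduce {p} (+ (t * y))) identity
  where
  ring : ∀ y x t r₁ r₂ → y *ᶻ r₁ -ᶻ x *ᶻ r₂ ≡ y *ᶻ (r₁ -ᶻ t *ᶻ x) +ᶻ -ᶻ x *ᶻ (r₂ -ᶻ t *ᶻ y)
  ring = solve-∀
  identity : + y *ᶻ + ((t * x) % p) -ᶻ + x *ᶻ + ((t * y) % p)
           ≡ + y *ᶻ (+ ((t * x) % p) -ᶻ + (t * x)) +ᶻ -ᶻ + x *ᶻ (+ ((t * y) % p) -ᶻ + (t * y))
  identity rewrite ℤ.pos-* t x | ℤ.pos-* t y =
    ring (+ y) (+ x) (+ t) (+ ((t * x) % p)) (+ ((t * y) % p))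

-- A reduced point on the line through (x,y) with 0 < x < p is a multiple
-- t·(x,y) modulo p: take t = a₁·x⁻¹.
onLine⇒multiple-of : ∀ {p} .{{_ : NonZero p}} → Prime p → ∀ {x y a₁ a₂} →
  0 < x → x < p → a₁ < p → a₂ < p → OnLine p x y a₁ a₂ →
  ∃ λ t → t < p × (t * x) % p ≡ a₁ × (t * y) % p ≡ a₂
onLine⇒multiple-of {p} p-prime {x} {y} {a₁} {a₂} 0<x x<p a₁<p a₂<p online =
  t , t<p , congruent⇒mod≡ (t * x) a₁ first a₁<p , congruent⇒mod≡ (t * y) a₂ second a₂<p
  where
  instance
    x≢0 : NonZero x
    x≢0 = ≢-nonZero (ℕ.m<n⇒n≢0 0<x)
  s : ℤ
  s = proj₁ (inverse (coprime-sym (prime⇒coprime p-prime x<p)))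
  xs≡1 : p ∣ᶻ + x *ᶻ s -ᶻ 1ℤ
  xs≡1 = proj₂ (inverse (coprime-sym (prime⇒coprime p-prime x<p)))
  t₀ : ℤ
  t₀ = + a₁ *ᶻ s
  t : ℕ
  t = t₀ %ℕ p
  t<p : t < p
  t<p = n%ℕd<d t₀ p
  first : p ∣ᶻ + (t * x) -ᶻ + a₁
  first = ∣-comb₂ (+ x) (+ a₁) (reduce {p} t₀) xs≡1
            (trans (cong (_-ᶻ + a₁) (ℤ.pos-* t x)) (ring (+ t) (+ x) (+ a₁) s))
    where ring : ∀ t x a₁ s → t *ᶻ x -ᶻ a₁ ≡ x *ᶻ (t -ᶻ a₁ *ᶻ s) +ᶻ a₁ *ᶻ (x *ᶻ s -ᶻ 1ℤ)
          ring = solve-∀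
  second : p ∣ᶻ + (t * y) -ᶻ + a₂
  second = ∣-comb₃ (+ y) s (+ a₂) (reduce {p} t₀) online xs≡1
             (trans (cong (_-ᶻ + a₂) (ℤ.pos-* t y)) (ring (+ t) (+ x) (+ y) (+ a₁) (+ a₂) s))
    where ring : ∀ t x y a₁ a₂ s → t *ᶻ y -ᶻ a₂
                   ≡ y *ᶻ (t -ᶻ a₁ *ᶻ s) +ᶻ s *ᶻ (y *ᶻ a₁ -ᶻ x *ᶻ a₂) +ᶻ a₂ *ᶻ (x *ᶻ s -ᶻ 1ℤ)
          ring = solve-∀

positive-coordinate : ∀ {x y} → ¬ (x ≡ 0 × y ≡ 0) → 0 < x ⊎ 0 < y
positive-coordinate {zero}  {zero}  nonzero = contradiction (refl , refl) nonzero
positive-coordinate {suc _}         _       = inj₁ (s≤s z≤n)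
positive-coordinate {zero}  {suc _} _       = inj₂ (s≤s z≤n)

onLine⇒multiple : ∀ {p} .{{_ : NonZero p}} → Prime p → ∀ {x y a₁ a₂} →
  x < p → y < p → ¬ (x ≡ 0 × y ≡ 0) → a₁ < p → a₂ < p → OnLine p x y a₁ a₂ →
  ∃ λ t → t < p × (t * x) % p ≡ a₁ × (t * y) % p ≡ a₂
onLine⇒multiple p-prime {x} {y} {a₁} {a₂} x<p y<p nonzero a₁<p a₂<p online
  with positive-coordinate nonzero
... | inj₁ 0<x = onLine⇒multiple-of p-prime 0<x x<p a₁<p a₂<p online
... | inj₂ 0<y =
  let t , t<p , e₂ , e₁ = onLine⇒multiple-of p-prime 0<y y<p a₂<p a₁<p
                            (onLine-swap {x = x} {y} {a₁} {a₂} online)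
  in  t , t<p , e₁ , e₂

isqrt : ∀ n → ∃ λ m → m * m ≤ n × n < suc m * suc m
isqrt zero = 0 , z≤n , s≤s z≤n
isqrt (suc n) with isqrt n
... | m , m²≤n , n<[m+1]² with suc n <? suc m * suc m
...   | yes n+1<[m+1]² = m , ℕ.m≤n⇒m≤1+n m²≤n , n+1<[m+1]²
...   | no  n+1≮[m+1]² = suc m , ℕ.≮⇒≥ n+1≮[m+1]² ,
                         ℕ.≤-<-trans n<[m+1]² (ℕ.*-mono-< (ℕ.n<1+n (suc m)) (ℕ.n<1+n (suc m)))

grid-det : ∀ {m} x y → Fin (suc m) × Fin (suc m) → ℤ
grid-det x y (i , j) = det x y (toℕ i) (toℕ j)

grid-collision : ∀ {p} .{{_ : NonZero p}} x y m → p < suc m * suc m →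
  ∃₂ λ (g₁ g₂ : Fin (suc m) × Fin (suc m)) → g₁ ≢ g₂ × grid-det x y g₁ %ℕ p ≡ grid-det x y g₂ %ℕ p
grid-collision {p} x y m p<[m+1]² with Fin.pigeonhole p<[m+1]² residue
  where
  residue : Fin (suc m * suc m) → Fin p
  residue k = fromℕ< (n%ℕd<d (grid-det x y (remQuot (suc m) k)) p)
... | k₁ , k₂ , k₁<k₂ , same = remQuot (suc m) k₁ , remQuot (suc m) k₂ , distinct , residues
  where
  distinct : remQuot (suc m) k₁ ≢ remQuot (suc m) k₂
  distinct eq = ℕ.<-irrefl (cong toℕ k₁≡k₂) k₁<k₂
    where
    k₁≡k₂ : k₁ ≡ k₂
    k₁≡k₂ = trans (sym (Fin.combine-remQuot {suc m} (suc m) k₁))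
                  (trans (cong (uncurry combine) eq) (Fin.combine-remQuot {suc m} (suc m) k₂))
  residues : grid-det x y (remQuot (suc m) k₁) %ℕ p ≡ grid-det x y (remQuot (suc m) k₂) %ℕ p
  residues = trans (sym (Fin.toℕ-fromℕ< (n%ℕd<d (grid-det x y (remQuot (suc m) k₁)) p)))
               (trans (cong toℕ same) (Fin.toℕ-fromℕ< (n%ℕd<d (grid-det x y (remQuot (suc m) k₂)) p)))

-- Thue's lemma: if p < (m+1)², the congruence y·U ≡ x·W (mod p) has a solution
-- (U,W) ≠ (0,0) with |U|, |W| ≤ m: subtract two colliding grid points.
thue : ∀ {p} .{{_ : NonZero p}} x y m → p < suc m * suc m →
  ∃₂ λ U W → ∣ U ∣ ≤ m × ∣ W ∣ ≤ m × ¬ (U ≡ 0ℤ × W ≡ 0ℤ) × p ∣ᶻ + y *ᶻ U -ᶻ + x *ᶻ W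
thue {p} x y m p<[m+1]² with grid-collision x y m p<[m+1]²
... | (i₁ , j₁) , (i₂ , j₂) , distinct , residues =
  + toℕ i₁ -ᶻ + toℕ i₂ , + toℕ j₁ -ᶻ + toℕ j₂ , ≤m i₁ i₂ , ≤m j₁ j₂ , nonzero ,
  ∣-comb₁ 1ℤ (same-residue (det x y (toℕ i₁) (toℕ j₁)) (det x y (toℕ i₂) (toℕ j₂)) residues)
             (ring (+ y) (+ x) (+ toℕ i₁) (+ toℕ i₂) (+ toℕ j₁) (+ toℕ j₂))
  where
  ≤m : ∀ (f g : Fin (suc m)) → ∣ + toℕ f -ᶻ + toℕ g ∣ ≤ m
  ≤m f g = ℕ.≤-trans (distance≤max (toℕ f) (toℕ g))
                     (ℕ.⊔-lub (ℕ.≤-pred (Fin.toℕ<n f)) (ℕ.≤-pred (Fin.toℕ<n g)))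
  difference-zero : ∀ (f g : Fin (suc m)) → + toℕ f -ᶻ + toℕ g ≡ 0ℤ → f ≡ g
  difference-zero f g d = Fin.toℕ-injective (ℤ.+-injective (ℤ.i-j≡0⇒i≡j (+ toℕ f) (+ toℕ g) d))
  nonzero : ¬ (+ toℕ i₁ -ᶻ + toℕ i₂ ≡ 0ℤ × + toℕ j₁ -ᶻ + toℕ j₂ ≡ 0ℤ)
  nonzero (U≡0 , W≡0) = distinct (cong₂ _,_ (difference-zero i₁ i₂ U≡0) (difference-zero j₁ j₂ W≡0))
  ring : ∀ y x i₁ i₂ j₁ j₂ → y *ᶻ (i₁ -ᶻ i₂) -ᶻ x *ᶻ (j₁ -ᶻ j₂)
           ≡ 1ℤ *ᶻ ((y *ᶻ i₁ -ᶻ x *ᶻ j₁) -ᶻ (y *ᶻ i₂ -ᶻ x *ᶻ j₂))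
  ring = solve-∀

ShortOnLine : ℕ → ℕ → ℕ → ℕ → Set
ShortOnLine p x y m = ∃₂ λ u w → u ≤ m × w ≤ m × ¬ (u ≡ 0 × w ≡ 0) × OnLine p x y u w

ShortOpposite : ℕ → ℕ → ℕ → ℕ → Set
ShortOpposite p x y m = ∃₂ λ u w → 1 ≤ u × u ≤ m × 1 ≤ w × w ≤ m × p ∣ᶻ + y *ᶻ + u +ᶻ + x *ᶻ + w

opposite-or-onLine : ∀ {p x y m} u w → u ≤ m → w ≤ m → ¬ (u ≡ 0 × w ≡ 0) →
  p ∣ᶻ + y *ᶻ + u +ᶻ + x *ᶻ + w → ShortOnLine p x y m ⊎ ShortOpposite p x y m
opposite-or-onLine {x = x} {y} zero w u≤m w≤m nonzero d =
  inj₁ (0 , w , u≤m , w≤m , nonzero , ∣-comb₁ -1ℤ d (ring (+ y) (+ x) (+ w)))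
  where ring : ∀ y x w → y *ᶻ 0ℤ -ᶻ x *ᶻ w ≡ -1ℤ *ᶻ (y *ᶻ 0ℤ +ᶻ x *ᶻ w)
        ring = solve-∀
opposite-or-onLine {x = x} {y} (suc u) zero u≤m w≤m nonzero d =
  inj₁ (suc u , 0 , u≤m , w≤m , nonzero , ∣-comb₁ 1ℤ d (ring (+ y) (+ x) (+ suc u)))
  where ring : ∀ y x u → y *ᶻ u -ᶻ x *ᶻ 0ℤ ≡ 1ℤ *ᶻ (y *ᶻ u +ᶻ x *ᶻ 0ℤ)
        ring = solve-∀
opposite-or-onLine (suc u) (suc w) u≤m w≤m _ d =
  inj₂ (suc u , suc w , s≤s z≤n , u≤m , s≤s z≤n , w≤m , d)

short-vector : ∀ {p x y m} U W → ∣ U ∣ ≤ m → ∣ W ∣ ≤ m → ¬ (U ≡ 0ℤ × W ≡ 0ℤ) →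
  p ∣ᶻ + y *ᶻ U -ᶻ + x *ᶻ W → ShortOnLine p x y m ⊎ ShortOpposite p x y m
short-vector (+ u) (+ w) u≤m w≤m nonzero d =
  inj₁ (u , w , u≤m , w≤m , (λ { (u≡0 , w≡0) → nonzero (cong +_ u≡0 , cong +_ w≡0) }) , d)
short-vector {x = x} {y} -[1+ u ] -[1+ w ] u≤m w≤m _ d =
  inj₁ (suc u , suc w , u≤m , w≤m , (λ ()) , ∣-comb₁ -1ℤ d (ring (+ y) (+ x) (+ suc u) (+ suc w)))
  where ring : ∀ y x u w → y *ᶻ u -ᶻ x *ᶻ w ≡ -1ℤ *ᶻ (y *ᶻ -ᶻ u -ᶻ x *ᶻ -ᶻ w)
        ring = solve-∀
short-vector {x = x} {y} (+ u) -[1+ w ] u≤m w≤m _ d =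
  opposite-or-onLine {x = x} {y} u (suc w) u≤m w≤m (λ ())
    (∣-comb₁ 1ℤ d (ring (+ y) (+ x) (+ u) (+ suc w)))
  where ring : ∀ y x u w → y *ᶻ u +ᶻ x *ᶻ w ≡ 1ℤ *ᶻ (y *ᶻ u -ᶻ x *ᶻ -ᶻ w)
        ring = solve-∀
short-vector {x = x} {y} -[1+ u ] (+ w) u≤m w≤m _ d =
  opposite-or-onLine {x = x} {y} (suc u) w u≤m w≤m (λ ())
    (∣-comb₁ -1ℤ d (ring (+ y) (+ x) (+ suc u) (+ w)))
  where ring : ∀ y x u w → y *ᶻ u +ᶻ x *ᶻ w ≡ -1ℤ *ᶻ (y *ᶻ -ᶻ u -ᶻ x *ᶻ w)
        ring = solve-∀

-- If gcd(u,w) = 1 and u·w ≤ N, then N = w·A + u·B with 1 ≤ B ≤ w: choose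
-- B ≡ N·u⁻¹ (mod w) in [1, w]; then u·B ≤ N and w divides N - u·B.
coprime-representation : ∀ N u w .{{_ : NonZero w}} → Coprime u w → u * w ≤ N →
  ∃₂ λ A B → 1 ≤ B × B ≤ w × w * A + u * B ≡ N
coprime-representation N u w coprime uw≤N = (N ∸ u * B) / w , B , s≤s z≤n , r<w , representation
  where
  s : ℤ
  s = proj₁ (inverse coprime)
  us≡1 : w ∣ᶻ + u *ᶻ s -ᶻ 1ℤ
  us≡1 = proj₂ (inverse coprime)
  r : ℕ
  r = (+ N *ᶻ s -ᶻ 1ℤ) %ℕ w
  r<w : suc r ≤ w
  r<w = n%ℕd<d (+ N *ᶻ s -ᶻ 1ℤ) w
  B : ℕ
  B = suc r
  uB≤N : u * B ≤ N
  uB≤N = ℕ.≤-trans (ℕ.*-monoʳ-≤ u r<w) uw≤N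
  w∣N-uB : w ∣ᶻ + (N ∸ u * B)
  w∣N-uB = ∣-comb₂ (-ᶻ + u) (-ᶻ + N) (reduce {w} (+ N *ᶻ s -ᶻ 1ℤ)) us≡1 identity
    where
    ring : ∀ N u r s → N -ᶻ u *ᶻ (1ℤ +ᶻ r) ≡ -ᶻ u *ᶻ (r -ᶻ (N *ᶻ s -ᶻ 1ℤ)) +ᶻ -ᶻ N *ᶻ (u *ᶻ s -ᶻ 1ℤ)
    ring = solve-∀
    identity : + (N ∸ u * B) ≡ -ᶻ + u *ᶻ (+ r -ᶻ (+ N *ᶻ s -ᶻ 1ℤ)) +ᶻ -ᶻ + N *ᶻ (+ u *ᶻ s -ᶻ 1ℤ)
    identity = begin
      + (N ∸ u * B)         ≡⟨ ℤ.⊖-≥ uB≤N ⟨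
      N ⊖ u * B             ≡⟨ ℤ.[+m]-[+n]≡m⊖n N (u * B) ⟨
      + N -ᶻ + (u * B)      ≡⟨ cong (λ t → + N -ᶻ t) (ℤ.pos-* u B) ⟩
      + N -ᶻ + u *ᶻ + B     ≡⟨ ring (+ N) (+ u) (+ r) s ⟩
      _                     ∎
      where open ≡-Reasoning
  representation : w * ((N ∸ u * B) / w) + u * B ≡ N
  representation = begin
    w * ((N ∸ u * B) / w) + u * B ≡⟨ cong (_+ u * B) (m*[n/m]≡n (Signed.∣⇒∣ᵤ w∣N-uB)) ⟩
    N ∸ u * B + u * B             ≡⟨ ℕ.m∸n+n≡m uB≤N ⟩
    N                             ∎
    where open ≡-Reasoning

-- Dividing a positive solution (u,w) of y·u + x·w ≡ 0 (mod p) by d = gcd(u,w)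
-- gives a coprime solution; p ∤ d because d ≤ u < p.
coprime-solution : ∀ {p x y u w} → Prime p → 1 ≤ u → 1 ≤ w → u < p →
  p ∣ᶻ + y *ᶻ + u +ᶻ + x *ᶻ + w →
  ∃₂ λ u′ w′ → Coprime u′ w′ × 1 ≤ u′ × 1 ≤ w′ × u′ ≤ u × w′ ≤ w × p ∣ᶻ + y *ᶻ + u′ +ᶻ + x *ᶻ + w′
coprime-solution {p} {x} {y} {u} {w} p-prime u≥1 w≥1 u<p p∣yu+xw =
  u / d , w / d , coprime-/gcd u w , m≥n⇒m/n>0 d≤u , m≥n⇒m/n>0 d≤w , m/n≤m u d , m/n≤m w d ,
  euclid (+ y *ᶻ + (u / d) +ᶻ + x *ᶻ + (w / d)) p-prime d≥1 (ℕ.≤-<-trans d≤u u<p)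
         (∣-comb₁ 1ℤ p∣yu+xw factored)
  where
  instance
    u≢0 : NonZero u
    u≢0 = ≢-nonZero (ℕ.m<n⇒n≢0 u≥1)
    w≢0 : NonZero w
    w≢0 = ≢-nonZero (ℕ.m<n⇒n≢0 w≥1)
  d : ℕ
  d = gcd u w
  d≢0 : d ≢ 0
  d≢0 = gcd[m,n]≢0 u w (inj₁ (ℕ.m<n⇒n≢0 u≥1))
  instance
    d-nonZero : NonZero d
    d-nonZero = ≢-nonZero d≢0
  d≥1 : 1 ≤ d
  d≥1 = ℕ.n≢0⇒n>0 d≢0
  d≤u : d ≤ u
  d≤u = ℕ.∣⇒≤ (gcd[m,n]∣m u w)
  d≤w : d ≤ w
  d≤w = ℕ.∣⇒≤ (gcd[m,n]∣n u w)
  ring : ∀ y x u′ w′ d → d *ᶻ (y *ᶻ u′ +ᶻ x *ᶻ w′) ≡ 1ℤ *ᶻ (y *ᶻ (u′ *ᶻ d) +ᶻ x *ᶻ (w′ *ᶻ d))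
  ring = solve-∀
  factored : + d *ᶻ (+ y *ᶻ + (u / d) +ᶻ + x *ᶻ + (w / d)) ≡ 1ℤ *ᶻ (+ y *ᶻ + u +ᶻ + x *ᶻ + w)
  factored = trans (ring (+ y) (+ x) (+ (u / d)) (+ (w / d)) (+ d))
    (cong₂ (λ s t → 1ℤ *ᶻ (+ y *ᶻ s +ᶻ + x *ᶻ t))
      (trans (sym (ℤ.pos-* (u / d) d)) (cong +_ (m/n*n≡m (gcd[m,n]∣m u w))))
      (trans (sym (ℤ.pos-* (w / d) d)) (cong +_ (m/n*n≡m (gcd[m,n]∣n u w)))))

-- If y·u + x·w ≡ 0 and w·A + u·B = p with 0 < w < p, then (A,B) is on the
-- line through (x,y), since w·(y·A - x·B) = y·p - B·(y·u + x·w).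
representation-onLine : ∀ {p x y u w A B} → Prime p → 0 < w → w < p →
  p ∣ᶻ + y *ᶻ + u +ᶻ + x *ᶻ + w → w * A + u * B ≡ p → OnLine p x y A B
representation-onLine {p} {x} {y} {u} {w} {A} {B} p-prime 0<w w<p p∣yu+xw representation =
  euclid _ p-prime 0<w w<p (∣-comb₂ (+ y) (-ᶻ + B) (∣-multiple {p} 1ℤ) p∣yu+xw identity)
  where
  ring : ∀ x y u w A B → w *ᶻ (y *ᶻ A -ᶻ x *ᶻ B)
           ≡ y *ᶻ (1ℤ *ᶻ (w *ᶻ A +ᶻ u *ᶻ B)) +ᶻ -ᶻ B *ᶻ (y *ᶻ u +ᶻ x *ᶻ w)
  ring = solve-∀
  identity : + w *ᶻ (+ y *ᶻ + A -ᶻ + x *ᶻ + B)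
           ≡ + y *ᶻ (1ℤ *ᶻ + p) +ᶻ -ᶻ + B *ᶻ (+ y *ᶻ + u +ᶻ + x *ᶻ + w)
  identity = trans (ring (+ x) (+ y) (+ u) (+ w) (+ A) (+ B))
    (cong (λ t → + y *ᶻ (1ℤ *ᶻ t) +ᶻ -ᶻ + B *ᶻ (+ y *ᶻ + u +ᶻ + x *ᶻ + w))
          (trans (sym (+-linear w A u B)) (cong +_ representation)))

-- If y·u + x·w ≡ 0, every point of the line through (x,y) ≢ 0 satisfies
-- w·a₁ + u·a₂ ≡ 0 (mod p), because
--   x·(w·a₁ + u·a₂) = a₁·(y·u + x·w) - u·(y·a₁ - x·a₂),
--   y·(w·a₁ + u·a₂) = w·(y·a₁ - x·a₂) + a₂·(y·u + x·w).
onLine⇒form-divisible : ∀ {p x y u w a₁ a₂} → Prime p → x < p → y < p → ¬ (x ≡ 0 × y ≡ 0) →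
  p ∣ᶻ + y *ᶻ + u +ᶻ + x *ᶻ + w → OnLine p x y a₁ a₂ → p ∣ᶻ + (w * a₁ + u * a₂)
onLine⇒form-divisible {p} {x} {y} {u} {w} {a₁} {a₂} p-prime x<p y<p nonzero p∣yu+xw online
  with positive-coordinate nonzero
... | inj₁ 0<x =
  euclid (+ (w * a₁ + u * a₂)) p-prime 0<x x<p (∣-comb₂ (+ a₁) (-ᶻ + u) p∣yu+xw online identity)
  where
  ring : ∀ x y u w a₁ a₂ → x *ᶻ (w *ᶻ a₁ +ᶻ u *ᶻ a₂)
           ≡ a₁ *ᶻ (y *ᶻ u +ᶻ x *ᶻ w) +ᶻ -ᶻ u *ᶻ (y *ᶻ a₁ -ᶻ x *ᶻ a₂)
  ring = solve-∀
  identity : + x *ᶻ + (w * a₁ + u * a₂) ≡ + a₁ *ᶻ (+ y *ᶻ + u +ᶻ + x *ᶻ + w) +ᶻ -ᶻ + u *ᶻ det x y a₁ a₂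
  identity = trans (cong (+ x *ᶻ_) (+-linear w a₁ u a₂)) (ring (+ x) (+ y) (+ u) (+ w) (+ a₁) (+ a₂))
... | inj₂ 0<y =
  euclid (+ (w * a₁ + u * a₂)) p-prime 0<y y<p (∣-comb₂ (+ w) (+ a₂) online p∣yu+xw identity)
  where
  ring : ∀ x y u w a₁ a₂ → y *ᶻ (w *ᶻ a₁ +ᶻ u *ᶻ a₂)
           ≡ w *ᶻ (y *ᶻ a₁ -ᶻ x *ᶻ a₂) +ᶻ a₂ *ᶻ (y *ᶻ u +ᶻ x *ᶻ w)
  ring = solve-∀
  identity : + y *ᶻ + (w * a₁ + u * a₂) ≡ + w *ᶻ det x y a₁ a₂ +ᶻ + a₂ *ᶻ (+ y *ᶻ + u +ᶻ + x *ᶻ + w)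
  identity = trans (cong (+ y *ᶻ_) (+-linear w a₁ u a₂)) (ring (+ x) (+ y) (+ u) (+ w) (+ a₁) (+ a₂))

-- If N = c·a + d·b with d, b ≥ 1 and b ≤ c, then (a + b)·c < N + c², because
-- (a + b)·c + d·b = N + c·b.
representation-bound : ∀ {N a b c d} → c * a + d * b ≡ N → 1 ≤ d → 1 ≤ b → b ≤ c →
  (a + b) * c < N + c * c
representation-bound {N} {a} {b} {c} {d} representation d≥1 b≥1 b≤c = begin-strict
  (a + b) * c          <⟨ ℕ.m<m+n ((a + b) * c) (ℕ.*-mono-≤ d≥1 b≥1) ⟩
  (a + b) * c + d * b  ≡⟨ expand ⟩
  N + c * b            ≤⟨ ℕ.+-monoʳ-≤ N (ℕ.*-monoʳ-≤ c b≤c) ⟩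
  N + c * c            ∎
  where
  open ℕ.≤-Reasoning
  ring : ∀ a b c d → (a + b) * c + d * b ≡ (c * a + d * b) + c * b
  ring = ℕ-Ring.solve-∀
  expand : (a + b) * c + d * b ≡ N + c * b
  expand = trans (ring a b c d) (cong (_+ c * b) representation)

form-positive : ∀ {u w a₁ a₂} → 1 ≤ u → 1 ≤ w → ¬ (a₁ ≡ 0 × a₂ ≡ 0) → 1 ≤ w * a₁ + u * a₂
form-positive {a₁ = zero}  {zero}  _   _   nonzero = contradiction (refl , refl) nonzero
form-positive {u} {w} {suc a₁} {a₂} _ w≥1 _ =
  ℕ.≤-trans (ℕ.*-mono-≤ w≥1 (s≤s (z≤n {a₁}))) (ℕ.m≤m+n (w * suc a₁) (u * a₂))
form-positive {u} {w} {zero} {suc a₂} u≥1 _ _ =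
  ℕ.≤-trans (ℕ.*-mono-≤ u≥1 (s≤s (z≤n {a₂}))) (ℕ.m≤n+m (u * suc a₂) (w * zero))

form≤ : ∀ {u w a₁ a₂ b} → u ≤ b → w ≤ b → w * a₁ + u * a₂ ≤ b * (a₁ + a₂)
form≤ {u} {w} {a₁} {a₂} {b} u≤b w≤b =
  ℕ.≤-trans (ℕ.+-mono-≤ (ℕ.*-monoˡ-≤ a₁ w≤b) (ℕ.*-monoˡ-≤ a₂ u≤b))
            (ℕ.≤-reflexive (sym (ℕ.*-distribˡ-+ b a₁ a₂)))

pred-square< : ∀ {k n} → 1 ≤ k → k ≤ n → (k ∸ 1) * (k ∸ 1) < n * n
pred-square< {suc k} _ k<n = ℕ.*-mono-< k<n k<n

LinePoint : ℕ → ℕ → ℕ → ℕ → ℕ → Set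
LinePoint p x y a₁ a₂ = a₁ < p × a₂ < p × ¬ (a₁ ≡ 0 × a₂ ≡ 0) × OnLine p x y a₁ a₂

MinimalHeight : ℕ → ℕ → ℕ → ℕ → Set
MinimalHeight p x y h = (∃₂ λ a₁ a₂ → LinePoint p x y a₁ a₂ × a₁ + a₂ ≡ h)
                      × (∀ a₁ a₂ → LinePoint p x y a₁ a₂ → h ≤ a₁ + a₂)

linePoint-swap : ∀ {p} x y a₁ a₂ → LinePoint p x y a₁ a₂ → LinePoint p y x a₂ a₁
linePoint-swap x y a₁ a₂ (a₁<p , a₂<p , nonzero , online) =
  a₂<p , a₁<p , (λ (e₂ , e₁) → nonzero (e₁ , e₂)) , onLine-swap {x = x} {y} {a₁} {a₂} online

minimalHeight-swap : ∀ {p} x y h → MinimalHeight p x y h → MinimalHeight p y x h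
minimalHeight-swap x y h ((a₁ , a₂ , point , height) , least) =
  (a₂ , a₁ , linePoint-swap x y a₁ a₂ point , trans (ℕ.+-comm a₂ a₁) height) ,
  λ a₂ a₁ point → subst (h ≤_) (ℕ.+-comm a₁ a₂) (least a₁ a₂ (linePoint-swap y x a₂ a₁ point))

height-positive : ∀ {a₁ a₂} → ¬ (a₁ ≡ 0 × a₂ ≡ 0) → 1 ≤ a₁ + a₂
height-positive {a₁} {a₂} nonzero with positive-coordinate nonzero
... | inj₁ a₁≥1 = ℕ.≤-trans a₁≥1 (ℕ.m≤m+n a₁ a₂)
... | inj₂ a₂≥1 = ℕ.≤-trans a₂≥1 (ℕ.m≤n+m a₂ a₁)

-- The two alternatives of the theorem, cleared of square roots and fractions:
-- 0 < h < 2√p + 1, and 0 ≤ h - p/b < b for some 1 ≤ b ≤ ⌈√p⌉.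
FirstAlternative : ℕ → ℕ → Set
FirstAlternative p h = 0 < h × (h ∸ 1) * (h ∸ 1) < 4 * p

SecondAlternative : ℕ → ℕ → Set
SecondAlternative p h =
  ∃ λ b → (1 ≤ b × (b ∸ 1) * (b ∸ 1) < p) × (p ≤ h * b × h * b < p + b * b)

-- A short line point (u,w) with u, w ≤ m gives 1 ≤ h ≤ 2m, hence
-- (h - 1)² < 4m² ≤ 4p.
onLine-case : ∀ {p x y m h} → MinimalHeight p x y h → m * m ≤ p → m < p →
  ShortOnLine p x y m → FirstAlternative p h
onLine-case {p} {x} {y} {m} {h} ((a₁ , a₂ , (_ , _ , a≢0 , _) , height) , least) m²≤p m<p
            (u , w , u≤m , w≤m , uw≢0 , online) =
  h≥1 , ℕ.<-≤-trans (pred-square< h≥1 h≤2m) [2m]²≤4p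
  where
  h≥1 : 1 ≤ h
  h≥1 = subst (1 ≤_) height (height-positive a≢0)
  h≤2m : h ≤ m + m
  h≤2m = ℕ.≤-trans (least u w (ℕ.≤-<-trans u≤m m<p , ℕ.≤-<-trans w≤m m<p , uw≢0 , online))
                   (ℕ.+-mono-≤ u≤m w≤m)
  ring : ∀ m → (m + m) * (m + m) ≡ 4 * (m * m)
  ring = ℕ-Ring.solve-∀
  [2m]²≤4p : (m + m) * (m + m) ≤ 4 * p
  [2m]²≤4p = subst (_≤ 4 * p) (sym (ring m)) (ℕ.*-monoʳ-≤ 4 m²≤p)

-- A representation p = w·A + u·B with u, B ≥ 1 and B ≤ w < p gives the line
-- point (A,B), so the minimal height h satisfies h·w ≤ (A + B)·w < p + w².
height-upper : ∀ {p x y h u w A B} → Prime p → (∀ a₁ a₂ → LinePoint p x y a₁ a₂ → h ≤ a₁ + a₂) →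
  p ∣ᶻ + y *ᶻ + u +ᶻ + x *ᶻ + w → 1 ≤ u → w < p → 1 ≤ B → B ≤ w → w * A + u * B ≡ p →
  h * w < p + w * w
height-upper {p} {x} {y} {h} {u} {w} {A} {B} p-prime least p∣yu+xw u≥1 w<p B≥1 B≤w representation =
  ℕ.≤-<-trans (ℕ.*-monoˡ-≤ w (least A B point))
              (representation-bound {p} {A} {B} {w} {u} representation u≥1 B≥1 B≤w)
  where
  w≥1 : 1 ≤ w
  w≥1 = ℕ.≤-trans B≥1 B≤w
  instance
    w≢0 : NonZero w
    w≢0 = ≢-nonZero (ℕ.m<n⇒n≢0 w≥1)
  wA<p : w * A < p
  wA<p = subst (w * A <_) representation (ℕ.m<m+n (w * A) (ℕ.*-mono-≤ u≥1 B≥1))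
  point : LinePoint p x y A B
  point = ℕ.≤-<-trans (ℕ.m≤n*m A w) wA<p , ℕ.≤-<-trans B≤w w<p ,
          (λ (_ , B≡0) → ℕ.<⇒≢ B≥1 (sym B≡0)) ,
          representation-onLine {p} {x} {y} {u} {w} {A} {B} p-prime w≥1 w<p p∣yu+xw representation

-- The upper bound h·w < p + w² comes
-- from the representation p = w·A + u·B; the lower bound from a minimal point
-- (a₁,a₂), as p ≤ w·a₁ + u·a₂ ≤ w·h.
opposite-ordered : ∀ {p x y m h u w} .{{_ : NonZero p}} → Prime p → m * m ≤ p → m < p →
  x < p → y < p → ¬ (x ≡ 0 × y ≡ 0) → MinimalHeight p x y h →
  Coprime u w → 1 ≤ u → u ≤ w → w ≤ m → p ∣ᶻ + y *ᶻ + u +ᶻ + x *ᶻ + w →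
  SecondAlternative p h
opposite-ordered {p} {x} {y} {m} {h} {u} {w} p-prime m²≤p m<p x<p y<p nonzero
                 ((a₁ , a₂ , (_ , _ , a≢0 , online) , height) , least)
                 coprime u≥1 u≤w w≤m p∣yu+xw =
  w , (w≥1 , ℕ.<-≤-trans (pred-square< w≥1 w≤m) m²≤p) , lower , upper
  where
  w≥1 : 1 ≤ w
  w≥1 = ℕ.≤-trans u≥1 u≤w
  w<p : w < p
  w<p = ℕ.≤-<-trans w≤m m<p
  instance
    w≢0 : NonZero w
    w≢0 = ≢-nonZero (ℕ.m<n⇒n≢0 w≥1)
  uw≤p : u * w ≤ p
  uw≤p = ℕ.≤-trans (ℕ.*-mono-≤ (ℕ.≤-trans u≤w w≤m) w≤m) m²≤p
  lower : p ≤ h * w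
  lower = begin
    p               ≤⟨ divisible⇒≥ (onLine⇒form-divisible {p} {x} {y} {u} {w} {a₁} {a₂}
                                      p-prime x<p y<p nonzero p∣yu+xw online)
                                   (form-positive u≥1 w≥1 a≢0) ⟩
    w * a₁ + u * a₂ ≤⟨ form≤ u≤w ℕ.≤-refl ⟩
    w * (a₁ + a₂)   ≡⟨ cong (w *_) height ⟩
    w * h           ≡⟨ ℕ.*-comm w h ⟩
    h * w           ∎
    where open ℕ.≤-Reasoning
  upper : h * w < p + w * w
  upper =
    let A , B , B≥1 , B≤w , representation = coprime-representation p u w coprime uw≤p
    in  height-upper {p} {x} {y} {h} {u} {w} {A} {B}
                     p-prime least p∣yu+xw u≥1 w<p B≥1 B≤w representation

opposite-case : ∀ {p x y m h} .{{_ : NonZero p}} → Prime p → m * m ≤ p → m < p →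
  x < p → y < p → ¬ (x ≡ 0 × y ≡ 0) → MinimalHeight p x y h →
  ShortOpposite p x y m → SecondAlternative p h
opposite-case {p} {x} {y} {m} {h} p-prime m²≤p m<p x<p y<p nonzero H
              (u , w , u≥1 , u≤m , w≥1 , w≤m , p∣yu+xw)
  with coprime-solution {p} {x} {y} {u} {w} p-prime u≥1 w≥1 (ℕ.≤-<-trans u≤m m<p) p∣yu+xw
... | u′ , w′ , coprime , u′≥1 , w′≥1 , u′≤u , w′≤w , p∣yu′+xw′ with ℕ.≤-total u′ w′
...   | inj₁ u′≤w′ =
  opposite-ordered {p} {x} {y} {m} {h} {u′} {w′} p-prime m²≤p m<p x<p y<p nonzero H
                   coprime u′≥1 u′≤w′ (ℕ.≤-trans w′≤w w≤m) p∣yu′+xw′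
...   | inj₂ w′≤u′ =
  opposite-ordered {p} {y} {x} {m} {h} {w′} {u′} p-prime m²≤p m<p y<p x<p
                   (λ (y≡0 , x≡0) → nonzero (x≡0 , y≡0)) (minimalHeight-swap x y h H)
                   (coprime-sym coprime) w′≥1 w′≤u′ (ℕ.≤-trans u′≤u u≤m)
                   (∣-comb₁ 1ℤ p∣yu′+xw′ (ring (+ x) (+ y) (+ u′) (+ w′)))
  where ring : ∀ x y u w → x *ᶻ w +ᶻ y *ᶻ u ≡ 1ℤ *ᶻ (y *ᶻ u +ᶻ x *ᶻ w)
        ring = solve-∀

root< : ∀ {m n} → m * m ≤ n → 1 < n → m < n
root< {zero}          _    1<n = ℕ.<-trans (s≤s z≤n) 1<n
root< {suc zero}      _    1<n = 1<n
root< {suc (suc k)}   m²≤n _   = ℕ.<-≤-trans (ℕ.m<m*n (suc (suc k)) (suc (suc k)) (s≤s (s≤s z≤n))) m²≤n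

line-height-alternatives : ∀ {p x y h} .{{_ : NonZero p}} → Prime p →
  x < p → y < p → ¬ (x ≡ 0 × y ≡ 0) → MinimalHeight p x y h →
  FirstAlternative p h ⊎ SecondAlternative p h
line-height-alternatives {p} {x} {y} {h} p-prime x<p y<p nonzero H =
  let m , m²≤p , p<[m+1]²             = isqrt p
      U , W , U≤m , W≤m , UW≢0 , p∣yU-xW = thue x y m p<[m+1]²
      m<p = root< m²≤p (nonTrivial⇒n>1 p {{prime⇒nonTrivial p-prime}})
  in  ⊎-map (onLine-case {p} {x} {y} {m} {h} H m²≤p m<p)
            (opposite-case {p} {x} {y} {m} {h} p-prime m²≤p m<p x<p y<p nonzero H)
            (short-vector {p} {x} {y} {m} U W U≤m W≤m UW≢0 p∣yU-xW)

toℕ-mod : ∀ {p} .{{_ : NonZero p}} c → toℕ (c mod p) ≡ c % p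
toℕ-mod {p} c = Fin.toℕ-fromℕ< (m%n<n c p)

inLine⇒onLine : ∀ {p} .{{_ : NonZero p}} (g v : Vec2 p) → InLine g v →
  OnLine p (toℕ (proj₁ g)) (toℕ (proj₂ g)) (toℕ (proj₁ v)) (toℕ (proj₂ v))
inLine⇒onLine {p} (gx , gy) _ (t , refl)
  rewrite toℕ-mod {p} (toℕ t * toℕ gx) | toℕ-mod {p} (toℕ t * toℕ gy) =
  multiple-onLine (toℕ t) (toℕ gx) (toℕ gy)

onLine⇒inLine : ∀ {p} .{{_ : NonZero p}} → Prime p → (g v : Vec2 p) → ¬ IsZeroVec g →
  OnLine p (toℕ (proj₁ g)) (toℕ (proj₂ g)) (toℕ (proj₁ v)) (toℕ (proj₂ v)) → InLine g v
onLine⇒inLine {p} p-prime (gx , gy) (v₁ , v₂) g≢0 online =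
  let t , t<p , e₁ , e₂ = onLine⇒multiple p-prime {toℕ gx} {toℕ gy} {toℕ v₁} {toℕ v₂}
                            (Fin.toℕ<n gx) (Fin.toℕ<n gy) g≢0 (Fin.toℕ<n v₁) (Fin.toℕ<n v₂) online
      coordinate : ∀ c (v : Fin p) → (t * c) % p ≡ toℕ v → v ≡ (toℕ (fromℕ< t<p) * c) mod p
      coordinate c v e = Fin.toℕ-injective (trans (sym e)
                             (sym (trans (toℕ-mod (toℕ (fromℕ< t<p) * c))
                                         (cong (λ s → (s * c) % p) (Fin.toℕ-fromℕ< t<p)))))
  in  fromℕ< t<p , cong₂ _,_ (coordinate (toℕ gx) v₁ e₁) (coordinate (toℕ gy) v₂ e₂)

isLineHeight⇒minimalHeight : ∀ {p h} .{{_ : NonZero p}} → Prime p → (g : Vec2 p) → ¬ IsZeroVec g →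
  IsLineHeight g h → MinimalHeight p (toℕ (proj₁ g)) (toℕ (proj₂ g)) h
isLineHeight⇒minimalHeight {p} {h} p-prime g@(gx , gy) g≢0 ((v , v∈g , v≢0 , height) , least) =
  attained , bound
  where
  attained : ∃₂ λ a₁ a₂ → LinePoint p (toℕ gx) (toℕ gy) a₁ a₂ × a₁ + a₂ ≡ h
  attained = toℕ (proj₁ v) , toℕ (proj₂ v) ,
             (Fin.toℕ<n (proj₁ v) , Fin.toℕ<n (proj₂ v) , v≢0 , inLine⇒onLine g v v∈g) , height
  bound : ∀ a₁ a₂ → LinePoint p (toℕ gx) (toℕ gy) a₁ a₂ → h ≤ a₁ + a₂
  bound a₁ a₂ (a₁<p , a₂<p , a≢0 , online) =
    subst₂ (λ s t → h ≤ s + t) (Fin.toℕ-fromℕ< a₁<p) (Fin.toℕ-fromℕ< a₂<p)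
      (least w (onLine⇒inLine p-prime g w g≢0 online′) w≢0)
    where
    w : Vec2 p
    w = fromℕ< a₁<p , fromℕ< a₂<p
    online′ : OnLine p (toℕ gx) (toℕ gy) (toℕ (fromℕ< a₁<p)) (toℕ (fromℕ< a₂<p))
    online′ = subst₂ (OnLine p (toℕ gx) (toℕ gy))
                     (sym (Fin.toℕ-fromℕ< a₁<p)) (sym (Fin.toℕ-fromℕ< a₂<p)) online
    w≢0 : ¬ IsZeroVec w
    w≢0 (e₁ , e₂) = a≢0 (trans (sym (Fin.toℕ-fromℕ< a₁<p)) e₁ , trans (sym (Fin.toℕ-fromℕ< a₂<p)) e₂)

corollary1 : ∀ (p : ℕ) .{{_ : NonZero p}} → Prime p →
    ∀ (g : Vec2 p) → ¬ IsZeroVec g →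
    ∀ (h : ℕ) → IsLineHeight g h →
    (0 < h × (h ∸ 1) * (h ∸ 1) < 4 * p)
    ⊎ (∃ λ (b : ℕ) → (1 ≤ b × (b ∸ 1) * (b ∸ 1) < p)
                     × (p ≤ h * b × h * b < p + b * b))
corollary1 p p-prime g@(gx , gy) g≢0 h H =
  line-height-alternatives p-prime (Fin.toℕ<n gx) (Fin.toℕ<n gy) g≢0
    (isLineHeight⇒minimalHeight p-prime g g≢0 H)
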